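{- Let $h \geq 0$ be an integer, let $\mathbb{F}_h$ be the Fibonacci tree of height $h$, and let $k$ be an integer with $0 \leq k \leq h$. Then the number $N(h,k)$ of vertices at level $k$ of $\mathbb{F}_h$ is $$N(h,k) = \sum_{i=0}^{h-k} \binom{k}{h-k-i}.$$
   Context: Fibonacci trees are rooted trees defined recursively: $\mathbb{F}_0$ is a single vertex (the root), $\mathbb{F}_1$ is $K_2$ (an edge, rooted at one of its endpoints), and for $h \geq 2$, $\mathbb{F}_h$ is obtained by taking a copy of $\mathbb{F}_{h-1}$, a copy of $\mathbb{F}_{h-2}$, and a new vertex $R$ (the root of $\mathbb{F}_h$), and joining $R$ to the roots of the two copies. The level of a vertex is its distance from the root (the root is at level $0$). Binomial coefficient convention: $\binom{n}{r} = 0$ if $r < 0$ or $r > n$. -}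

module Defs where

open import Data.Nat using (ℕ; zero; suc; _+_; _∸_)
open import Data.List using (List; []; _∷_)

data Tree : Set where
  node : List Tree → Tree

mutual
  levelCount : Tree → ℕ → ℕ
  levelCount (node ts) zero    = 1
  levelCount (node ts) (suc k) = levelCountList ts k

  levelCountList : List Tree → ℕ → ℕ
  levelCountList []       k = 0
  levelCountList (t ∷ ts) k = levelCount t k + levelCountList ts k

fib-tree : ℕ → Tree
fib-tree zero          = node []
fib-tree (suc zero)    = node (node [] ∷ [])
fib-tree (suc (suc h)) = node (fib-tree (suc h) ∷ fib-tree h ∷ [])

-- Levels of F_{h+2} below the root are the levels of F_{h+1} and F_h shifted
-- by one, so N(h+2, k+1) = N(h+1, k) + N(h, k). Writing h = k + m, the partial
-- row sums S(k, m) = Σ_{j ≤ m} C(k, j) obey the same recurrence by Pascal's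
-- rule, S(k+1, m+1) = S(k, m+1) + S(k, m), and both agree on the boundary
-- k = 0 and m = 0; the sum in the statement is S(k, h - k) read backwards.
module Submission where

open import Defs
open import Data.Nat using (ℕ; zero; suc; _+_; _∸_; _≤_; _<_; s≤s)
open import Data.Nat.Combinatorics using (_C_; nCk+nC[k+1]≡[n+1]C[k+1])
open import Data.Nat.ListAction using (sum)
open import Data.Nat.Properties using (+-identityʳ; +-suc; +-comm; m+[n∸m]≡n; n<1+n; <-trans)
open import Data.Nat.Tactic.RingSolver using (solve-∀)
open import Data.List using (map; upTo; applyUpTo)
open import Data.List.Properties using (map-applyUpTo)
open import Relation.Binary.PropositionalEquality
  using (_≡_; refl; sym; trans; cong; cong₂; subst; module ≡-Reasoning)

prefixSum : (ℕ → ℕ) → ℕ → ℕ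
prefixSum g zero    = g 0
prefixSum g (suc m) = g (suc m) + prefixSum g m

sum-applyUpTo-reflect : ∀ g m → sum (applyUpTo (λ i → g (m ∸ i)) (suc m)) ≡ prefixSum g m
sum-applyUpTo-reflect g zero    = +-identityʳ (g 0)
sum-applyUpTo-reflect g (suc m) = cong (g (suc m) +_) (sum-applyUpTo-reflect g m)

prefixSum-0C : ∀ m → prefixSum (0 C_) m ≡ 1
prefixSum-0C zero    = refl
prefixSum-0C (suc m) = prefixSum-0C m

prefixSum-pascal : ∀ n m →
  prefixSum (suc n C_) (suc m) ≡ prefixSum (n C_) (suc m) + prefixSum (n C_) m
prefixSum-pascal n zero    =
  cong (_+ 1) (trans (sym (nCk+nC[k+1]≡[n+1]C[k+1] n 0)) (+-comm 1 (n C 1)))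
prefixSum-pascal n (suc m) = begin
  suc n C suc (suc m) + prefixSum (suc n C_) (suc m)
    ≡⟨ cong₂ _+_ (sym (nCk+nC[k+1]≡[n+1]C[k+1] n (suc m))) (prefixSum-pascal n m) ⟩
  (n C suc m + n C suc (suc m)) + (prefixSum (n C_) (suc m) + prefixSum (n C_) m)
    ≡⟨ +-interchange (n C suc m) (n C suc (suc m)) (prefixSum (n C_) (suc m)) (prefixSum (n C_) m) ⟩
  prefixSum (n C_) (suc (suc m)) + prefixSum (n C_) (suc m) ∎
  where
  open ≡-Reasoning
  +-interchange : ∀ a b c d → (a + b) + (c + d) ≡ (b + c) + (a + d)
  +-interchange = solve-∀

levelCount-fib-tree-suc : ∀ h k →
  levelCount (fib-tree (suc (suc h))) (suc k)
    ≡ levelCount (fib-tree (suc h)) k + levelCount (fib-tree h) k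
levelCount-fib-tree-suc h k = cong (levelCount (fib-tree (suc h)) k +_) (+-identityʳ _)

levelCount-fib-tree-root : ∀ h → levelCount (fib-tree h) 0 ≡ 1
levelCount-fib-tree-root zero          = refl
levelCount-fib-tree-root (suc zero)    = refl
levelCount-fib-tree-root (suc (suc h)) = refl

levelCount-fib-tree-beyond : ∀ {h k} → h < k → levelCount (fib-tree h) k ≡ 0
levelCount-fib-tree-beyond {zero}        {suc k}       _ = refl
levelCount-fib-tree-beyond {suc zero}    {suc zero}    (s≤s ())
levelCount-fib-tree-beyond {suc zero}    {suc (suc k)} _ = refl
levelCount-fib-tree-beyond {suc (suc h)} {suc k} (s≤s 1+h<k) =
  trans (levelCount-fib-tree-suc h k)
        (cong₂ _+_ (levelCount-fib-tree-beyond 1+h<k)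
                   (levelCount-fib-tree-beyond (<-trans (n<1+n h) 1+h<k)))

levelCount-fib-tree-height : ∀ h → levelCount (fib-tree h) h ≡ 1
levelCount-fib-tree-height zero          = refl
levelCount-fib-tree-height (suc zero)    = refl
levelCount-fib-tree-height (suc (suc h)) =
  trans (levelCount-fib-tree-suc h (suc h))
        (cong₂ _+_ (levelCount-fib-tree-height (suc h))
                   (levelCount-fib-tree-beyond (n<1+n h)))

levelCount-fib-tree-prefixSum : ∀ k m → levelCount (fib-tree (k + m)) k ≡ prefixSum (k C_) m
levelCount-fib-tree-prefixSum zero    m       =
  trans (levelCount-fib-tree-root m) (sym (prefixSum-0C m))
levelCount-fib-tree-prefixSum (suc k) zero    =
  subst (λ h → levelCount (fib-tree h) (suc k) ≡ 1) (sym (+-identityʳ (suc k)))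
        (levelCount-fib-tree-height (suc k))
levelCount-fib-tree-prefixSum (suc k) (suc m) = begin
  levelCount (fib-tree (suc (k + suc m))) (suc k)
    ≡⟨ cong (λ h → levelCount (fib-tree (suc h)) (suc k)) (+-suc k m) ⟩
  levelCount (fib-tree (suc (suc (k + m)))) (suc k)
    ≡⟨ levelCount-fib-tree-suc (k + m) k ⟩
  levelCount (fib-tree (suc (k + m))) k + levelCount (fib-tree (k + m)) k
    ≡⟨ cong (λ h → levelCount (fib-tree h) k + levelCount (fib-tree (k + m)) k) (sym (+-suc k m)) ⟩
  levelCount (fib-tree (k + suc m)) k + levelCount (fib-tree (k + m)) k
    ≡⟨ cong₂ _+_ (levelCount-fib-tree-prefixSum k (suc m)) (levelCount-fib-tree-prefixSum k m) ⟩
  prefixSum (k C_) (suc m) + prefixSum (k C_) m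
    ≡⟨ sym (prefixSum-pascal k m) ⟩
  prefixSum (suc k C_) (suc m) ∎
  where open ≡-Reasoning

lemma2p1 : (h k : ℕ) → k ≤ h →
    levelCount (fib-tree h) k ≡ sum (map (λ i → k C ((h ∸ k) ∸ i)) (upTo (suc (h ∸ k))))
lemma2p1 h k k≤h = begin
  levelCount (fib-tree h) k
    ≡⟨ cong (λ h′ → levelCount (fib-tree h′) k) (sym (m+[n∸m]≡n k≤h)) ⟩
  levelCount (fib-tree (k + (h ∸ k))) k
    ≡⟨ levelCount-fib-tree-prefixSum k (h ∸ k) ⟩
  prefixSum (k C_) (h ∸ k)
    ≡⟨ sym (sum-applyUpTo-reflect (k C_) (h ∸ k)) ⟩
  sum (applyUpTo (λ i → k C ((h ∸ k) ∸ i)) (suc (h ∸ k)))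
    ≡⟨ cong sum (sym (map-applyUpTo (λ i → i) (λ i → k C ((h ∸ k) ∸ i)) (suc (h ∸ k)))) ⟩
  sum (map (λ i → k C ((h ∸ k) ∸ i)) (upTo (suc (h ∸ k)))) ∎
  where open ≡-Reasoning
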